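{- Let $\alpha$ be a positive integer. For $n\ge 0$ set \[ a_n=\sum_{i=0}^{\lfloor n/3\rfloor}\binom{n-2i}{i}3^{\,n-3i}\alpha^{\,n-i}(\alpha-1)^{2i}. \] Then \[ \lim_{n\to\infty}\left(1+\frac{\alpha^{2}-1}{\dfrac{a_n}{a_{n-1}}-\alpha+1}\right)=\alpha^{2/3}. \] -}

module Defs where

open import Data.Nat as ℕ using (ℕ; zero; suc; _∸_; _/_)
open import Data.Nat.Combinatorics using (_C_)
open import Data.Integer as ℤ using (+_)
open import Data.Rational as ℚ using (ℚ; 0ℚ; _≟_; _÷_; ≢-nonZero; _<_; _≤_)
open import Data.Sum using (_⊎_)
open import Data.Product using (_×_)
open import Relation.Nullary using (yes; no)

sumTo : ℕ → (ℕ → ℕ) → ℕ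
sumTo zero    f = f 0
sumTo (suc m) f = sumTo m f ℕ.+ f (suc m)

a : (α n : ℕ) → ℕ
a α n = sumTo (n / 3) λ i →
  ((n ∸ 2 ℕ.* i) C i) ℕ.* 3 ℕ.^ (n ∸ 3 ℕ.* i)
    ℕ.* α ℕ.^ (n ∸ i) ℕ.* (α ∸ 1) ℕ.^ (2 ℕ.* i)

⟦_⟧ : ℕ → ℚ
⟦ n ⟧ = + n ℚ./ 1

-- total division (value 0 when the divisor is 0); the statement below
-- separately asserts that all divisors involved are nonzero
_÷₀_ : ℚ → ℚ → ℚ
p ÷₀ q with q ≟ 0ℚ
... | yes _ = 0ℚ
... | no q≢0 = _÷_ p q {{≢-nonZero q≢0}}

ratio : (α n : ℕ) → ℚ
ratio α n = ⟦ a α n ⟧ ÷₀ ⟦ a α (n ∸ 1) ⟧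

den : (α n : ℕ) → ℚ
den α n = ratio α n ℚ.- ⟦ α ⟧ ℚ.+ ℚ.1ℚ

x : (α n : ℕ) → ℚ
x α n = ℚ.1ℚ ℚ.+ ((⟦ α ⟧ ℚ.* ⟦ α ⟧ ℚ.- ℚ.1ℚ) ÷₀ den α n)

-- Dedekind cut of the real number α^{2/3} (α ≥ 1):
-- q < α^{2/3}  iff  q < 0 or q³ < α²
below : ℕ → ℚ → Set
below α q = (q < 0ℚ) ⊎ (q ℚ.* q ℚ.* q < ⟦ α ⟧ ℚ.* ⟦ α ⟧)

-- α^{2/3} < r  iff  0 ≤ r and α² < r³
above : ℕ → ℚ → Set
above α r = (0ℚ ≤ r) × (⟦ α ⟧ ℚ.* ⟦ α ⟧ < r ℚ.* r ℚ.* r)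

{-# OPTIONS --safe #-}
module Submission where

-- The coefficients count weighted words in letters of length 1 and 3,
--   a n = Σ_{3i+r=n} C(i+r,i) k^r c^i  with  k = 3α, c = α²(α-1)²,
-- hence a (n+3) = k a (n+2) + c a n. The ratios ρ n = a (n+1) / a n converge to the positive
-- root λ of (λ - k) λ² = c: if all ratios from some index on lie in [l, u], then three steps
-- later they lie in [k + θ l, k + θ u] with θ = c / (k l u + c) ≤ c / (k³ + c) < 1, and every
-- such interval satisfies (l - k) l² ≤ c ≤ (u - k) u². The substitution
-- ρ = (α - 1) + (α² - 1) / (t - 1), inverse to ρ ↦ 1 + (α² - 1) / (ρ - α + 1), turns
-- ((ρ - k) ρ² - c) (t - 1)³ into (α² - 1)² (α² - t³), so λ corresponds to t = α^{2/3}: a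
-- rational below (above) α^{2/3} is sent to one above (below) λ, which the ratios eventually
-- stay below (above).

open import Defs

module Coefficients where

  open import Data.Nat as ℕ using (ℕ; zero; suc; _+_; _*_; _∸_; _^_; _/_; z≤n; s≤s)
  import Data.Nat.Properties as ℕP
  open import Data.Nat.Combinatorics using (_C_; nCn≡1; k>n⇒nCk≡0; nCk+nC[k+1]≡[n+1]C[k+1])
  open import Data.Nat.DivMod using (m/n≤m; m*n/n≡m; /-monoˡ-≤)
  open import Data.Nat.Tactic.RingSolver using (solve-∀)
  open import Algebra.Properties.CommutativeSemigroup ℕP.+-commutativeSemigroup using (interchange)
  open import Data.Sum using (inj₁; inj₂)
  open import Data.Product using (_,_)
  open import Relation.Binary.PropositionalEquality

  sumTo-cong : ∀ m {f g : ℕ → ℕ} → (∀ i → f i ≡ g i) → sumTo m f ≡ sumTo m g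
  sumTo-cong zero    f≗g = f≗g 0
  sumTo-cong (suc m) f≗g = cong₂ _+_ (sumTo-cong m f≗g) (f≗g (suc m))

  sumTo-+ : ∀ m (f g : ℕ → ℕ) → sumTo m (λ i → f i + g i) ≡ sumTo m f + sumTo m g
  sumTo-+ zero    f g = refl
  sumTo-+ (suc m) f g = trans (cong (_+ (f (suc m) + g (suc m))) (sumTo-+ m f g))
                              (interchange (sumTo m f) (sumTo m g) (f (suc m)) (g (suc m)))

  sumTo-*ˡ : ∀ m k (f : ℕ → ℕ) → sumTo m (λ i → k * f i) ≡ k * sumTo m f
  sumTo-*ˡ zero    k f = refl
  sumTo-*ˡ (suc m) k f = trans (cong (_+ k * f (suc m)) (sumTo-*ˡ m k f))
                               (sym (ℕP.*-distribˡ-+ k (sumTo m f) (f (suc m))))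

  sumTo-suc : ∀ m (f : ℕ → ℕ) → sumTo (suc m) f ≡ f 0 + sumTo m (λ i → f (suc i))
  sumTo-suc zero    f = refl
  sumTo-suc (suc m) f = trans (cong (_+ f (2 + m)) (sumTo-suc m f)) (ℕP.+-assoc (f 0) _ _)

  sumTo-extend : ∀ {m m′} (f : ℕ → ℕ) → m ℕ.≤ m′ → (∀ i → m ℕ.< i → f i ≡ 0) →
                 sumTo m′ f ≡ sumTo m f
  sumTo-extend {m} f m≤m′ vanish = go (ℕP.≤⇒≤′ m≤m′)
    where
    go : ∀ {m′} → m ℕ.≤′ m′ → sumTo m′ f ≡ sumTo m f
    go ℕ.≤′-refl            = refl
    go (ℕ.≤′-step {n} m≤′n) = begin
      sumTo n f + f (suc n) ≡⟨ cong₂ _+_ (go m≤′n) (vanish (suc n) (s≤s (ℕP.≤′⇒≤ m≤′n))) ⟩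
      sumTo m f + 0         ≡⟨ ℕP.+-identityʳ _ ⟩
      sumTo m f             ∎
      where open ≡-Reasoning

  weight : (k c i r : ℕ) → ℕ
  weight k c i r = ((i + r) C i) * k ^ r * c ^ i

  weight-zero-suc : ∀ k c r → weight k c 0 (suc r) ≡ k * weight k c 0 r
  weight-zero-suc k c r = shuffle k (k ^ r)
    where
    shuffle : ∀ k p → 1 * (k * p) * 1 ≡ k * (1 * p * 1)
    shuffle = solve-∀

  weight-suc-zero : ∀ k c i → weight k c (suc i) 0 ≡ c * weight k c i 0
  weight-suc-zero k c i = begin
    ((suc i + 0) C suc i) * 1 * (c * c ^ i) ≡⟨ cong (λ b → b * 1 * (c * c ^ i)) (C-diag (suc i)) ⟩
    1 * 1 * (c * c ^ i)                     ≡⟨ shuffle c (c ^ i) ⟩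
    c * (1 * 1 * c ^ i)                     ≡⟨ cong (λ b → c * (b * 1 * c ^ i)) (C-diag i) ⟨
    c * (((i + 0) C i) * 1 * c ^ i)         ∎
    where
    open ≡-Reasoning
    C-diag : ∀ n → (n + 0) C n ≡ 1
    C-diag n = trans (cong (_C n) (ℕP.+-identityʳ n)) (nCn≡1 n)
    shuffle : ∀ c p → 1 * 1 * (c * p) ≡ c * (1 * 1 * p)
    shuffle = solve-∀

  weight-suc-suc : ∀ k c i r →
    weight k c (suc i) (suc r) ≡ k * weight k c (suc i) r + c * weight k c i (suc r)
  weight-suc-suc k c i r = begin
    (suc (i + suc r) C suc i) * (k * k ^ r) * (c * c ^ i)
      ≡⟨ cong (λ b → b * (k * k ^ r) * (c * c ^ i)) (sym (nCk+nC[k+1]≡[n+1]C[k+1] (i + suc r) i)) ⟩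
    (((i + suc r) C i) + ((i + suc r) C suc i)) * (k * k ^ r) * (c * c ^ i)
      ≡⟨ shuffle k c ((i + suc r) C i) ((i + suc r) C suc i) (k ^ r) (c ^ i) ⟩
    k * (((i + suc r) C suc i) * k ^ r * (c * c ^ i)) + c * (((i + suc r) C i) * (k * k ^ r) * c ^ i)
      ≡⟨ cong (λ n → k * ((n C suc i) * k ^ r * (c * c ^ i)) + c * weight k c i (suc r)) (ℕP.+-suc i r) ⟩
    k * weight k c (suc i) r + c * weight k c i (suc r) ∎
    where
    open ≡-Reasoning
    shuffle : ∀ k c b b′ p q → (b + b′) * (k * p) * (c * q) ≡ k * (b′ * p * (c * q)) + c * (b * (k * p) * q)
    shuffle = solve-∀

  ^-distribʳ-* : ∀ m n k → (m * n) ^ k ≡ m ^ k * n ^ k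
  ^-distribʳ-* m n zero    = refl
  ^-distribʳ-* m n (suc k) = trans (cong (m * n *_) (^-distribʳ-* m n k)) (shuffle m n (m ^ k) (n ^ k))
    where
    shuffle : ∀ m n p q → m * n * (p * q) ≡ m * p * (n * q)
    shuffle = solve-∀

  m≡n+o⇒m∸n≡o : ∀ {m} n {o} → m ≡ n + o → m ∸ n ≡ o
  m≡n+o⇒m∸n≡o n {o} refl = ℕP.m+n∸m≡n n o

  γ : ℕ → ℕ
  γ α = (α * (α ∸ 1)) ^ 2

  term : (α n i : ℕ) → ℕ
  term α n i = ((n ∸ 2 * i) C i) * 3 ^ (n ∸ 3 * i) * α ^ (n ∸ i) * (α ∸ 1) ^ (2 * i)

  term-vanishes : ∀ α n i → n ℕ.< 3 * i → term α n i ≡ 0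
  term-vanishes α n (suc i) n<3i =
    cong (λ b → b * 3 ^ (n ∸ 3 * suc i) * α ^ (n ∸ suc i) * (α ∸ 1) ^ (2 * suc i))
         (k>n⇒nCk≡0 (ℕP.m<n+o⇒m∸n<o n (2 * suc i) (subst (n ℕ.<_) (split i) n<3i)))
    where
    split : ∀ i → 3 * suc i ≡ 2 * suc i + suc i
    split = solve-∀

  term-at : ∀ α {n} i r → n ≡ 3 * i + r → term α n i ≡ weight (3 * α) (γ α) i r
  term-at α i r refl = begin
    term α (3 * i + r) i
      ≡⟨ exponents (m≡n+o⇒m∸n≡o (2 * i) (e₁ i r)) (m≡n+o⇒m∸n≡o (3 * i) refl) (m≡n+o⇒m∸n≡o i (e₃ i r)) ⟩
    ((i + r) C i) * 3 ^ r * α ^ (2 * i + r) * β ^ (2 * i)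
      ≡⟨ cong (λ p → ((i + r) C i) * 3 ^ r * p * β ^ (2 * i)) (ℕP.^-distribˡ-+-* α (2 * i) r) ⟩
    ((i + r) C i) * 3 ^ r * (α ^ (2 * i) * α ^ r) * β ^ (2 * i)
      ≡⟨ shuffle ((i + r) C i) (3 ^ r) (α ^ (2 * i)) (α ^ r) (β ^ (2 * i)) ⟩
    ((i + r) C i) * (3 ^ r * α ^ r) * (α ^ (2 * i) * β ^ (2 * i))
      ≡⟨ sym (cong₂ (λ p q → ((i + r) C i) * p * q) (^-distribʳ-* 3 α r) (^-distribʳ-* α β (2 * i))) ⟩
    ((i + r) C i) * (3 * α) ^ r * (α * β) ^ (2 * i)
      ≡⟨ cong (((i + r) C i) * (3 * α) ^ r *_) (sym (ℕP.^-*-assoc (α * β) 2 i)) ⟩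
    weight (3 * α) (γ α) i r ∎
    where
    open ≡-Reasoning
    β : ℕ
    β = α ∸ 1
    exponents : ∀ {p q s} → 3 * i + r ∸ 2 * i ≡ p → 3 * i + r ∸ 3 * i ≡ q → 3 * i + r ∸ i ≡ s →
                term α (3 * i + r) i ≡ (p C i) * 3 ^ q * α ^ s * β ^ (2 * i)
    exponents refl refl refl = refl
    e₁ : ∀ i r → 3 * i + r ≡ 2 * i + (i + r)
    e₁ = solve-∀
    e₃ : ∀ i r → 3 * i + r ≡ i + (2 * i + r)
    e₃ = solve-∀
    shuffle : ∀ b t p q u → b * t * (p * q) * u ≡ b * (t * q) * (p * u)
    shuffle = solve-∀

  term-rec-zero : ∀ α n → term α (3 + n) 0 ≡ 3 * α * term α (2 + n) 0
  term-rec-zero α n = begin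
    term α (3 + n) 0                     ≡⟨ term-at α 0 (3 + n) refl ⟩
    weight (3 * α) (γ α) 0 (3 + n)       ≡⟨ weight-zero-suc (3 * α) (γ α) (2 + n) ⟩
    3 * α * weight (3 * α) (γ α) 0 (2 + n) ≡⟨ cong (3 * α *_) (term-at α 0 (2 + n) refl) ⟨
    3 * α * term α (2 + n) 0             ∎
    where open ≡-Reasoning

  term-rec-< : ∀ α n i → n ℕ.< 3 * i →
    term α (3 + n) (suc i) ≡ 3 * α * term α (2 + n) (suc i) + γ α * term α n i
  term-rec-< α n i n<3i = begin
    term α (3 + n) (suc i)
      ≡⟨ term-vanishes α (3 + n) (suc i) (subst (3 + n ℕ.<_) (sym (three i)) (ℕP.+-monoʳ-< 3 n<3i)) ⟩
    0
      ≡⟨ cong₂ _+_ (ℕP.*-zeroʳ (3 * α)) (ℕP.*-zeroʳ (γ α)) ⟨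
    3 * α * 0 + γ α * 0
      ≡⟨ cong₂ (λ p q → 3 * α * p + γ α * q) (term-vanishes α (2 + n) (suc i) 2+n<3[1+i]) (term-vanishes α n i n<3i) ⟨
    3 * α * term α (2 + n) (suc i) + γ α * term α n i ∎
    where
    open ≡-Reasoning
    three : ∀ i → 3 * suc i ≡ 3 + 3 * i
    three = solve-∀
    2+n<3[1+i] : 2 + n ℕ.< 3 * suc i
    2+n<3[1+i] = subst (2 + n ℕ.<_) (sym (three i)) (ℕP.<-trans (ℕP.+-monoʳ-< 2 n<3i) (ℕP.n<1+n _))

  term-rec-3i : ∀ α i →
    term α (3 + 3 * i) (suc i) ≡ 3 * α * term α (2 + 3 * i) (suc i) + γ α * term α (3 * i) i
  term-rec-3i α i = begin
    term α (3 + 3 * i) (suc i)           ≡⟨ term-at α (suc i) 0 (e₁ i) ⟩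
    weight k g (suc i) 0                 ≡⟨ weight-suc-zero k g i ⟩
    g * weight k g i 0                   ≡⟨ cong (g *_) (term-at α i 0 (sym (ℕP.+-identityʳ (3 * i)))) ⟨
    g * term α (3 * i) i                 ≡⟨ cong (_+ g * term α (3 * i) i) (ℕP.*-zeroʳ k) ⟨
    k * 0 + g * term α (3 * i) i         ≡⟨ cong (λ p → k * p + g * term α (3 * i) i) vanishes ⟨
    k * term α (2 + 3 * i) (suc i) + g * term α (3 * i) i ∎
    where
    open ≡-Reasoning
    k : ℕ
    k = 3 * α
    g : ℕ
    g = γ α
    e₁ : ∀ i → 3 + 3 * i ≡ 3 * suc i + 0
    e₁ = solve-∀
    e₂ : ∀ i → 3 + 3 * i ≡ 3 * suc i
    e₂ = solve-∀
    vanishes : term α (2 + 3 * i) (suc i) ≡ 0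
    vanishes = term-vanishes α (2 + 3 * i) (suc i) (ℕP.≤-reflexive (e₂ i))

  term-rec-3i+ : ∀ α i r →
    term α (3 + (3 * i + suc r)) (suc i)
      ≡ 3 * α * term α (2 + (3 * i + suc r)) (suc i) + γ α * term α (3 * i + suc r) i
  term-rec-3i+ α i r = begin
    term α (3 + (3 * i + suc r)) (suc i)                 ≡⟨ term-at α (suc i) (suc r) (e₁ i r) ⟩
    weight k g (suc i) (suc r)                           ≡⟨ weight-suc-suc k g i r ⟩
    k * weight k g (suc i) r + g * weight k g i (suc r)
      ≡⟨ cong₂ (λ p q → k * p + g * q) (term-at α (suc i) r (e₂ i r)) (term-at α i (suc r) refl) ⟨
    k * term α (2 + (3 * i + suc r)) (suc i) + g * term α (3 * i + suc r) i ∎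
    where
    open ≡-Reasoning
    k : ℕ
    k = 3 * α
    g : ℕ
    g = γ α
    e₁ : ∀ i r → 3 + (3 * i + suc r) ≡ 3 * suc i + suc r
    e₁ = solve-∀
    e₂ : ∀ i r → 2 + (3 * i + suc r) ≡ 3 * suc i + r
    e₂ = solve-∀

  term-rec : ∀ α n i →
    term α (3 + n) (suc i) ≡ 3 * α * term α (2 + n) (suc i) + γ α * term α n i
  term-rec α n i with ℕP.<-≤-connex n (3 * i)
  ... | inj₁ n<3i = term-rec-< α n i n<3i
  ... | inj₂ 3i≤n with ℕP.m≤n⇒∃[o]m+o≡n 3i≤n
  ...   | zero  , refl = subst (λ n → term α (3 + n) (suc i) ≡ 3 * α * term α (2 + n) (suc i) + γ α * term α n i)
                               (sym (ℕP.+-identityʳ (3 * i))) (term-rec-3i α i)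
  ...   | suc r , refl = term-rec-3i+ α i r

  /3<⇒<3* : ∀ {n i} → n / 3 ℕ.< i → n ℕ.< 3 * i
  /3<⇒<3* {n} {i} n/3<i = ℕP.≰⇒> λ 3i≤n → ℕP.<⇒≱ n/3<i (begin
    i         ≡⟨ m*n/n≡m i 3 ⟨
    i * 3 / 3 ≤⟨ /-monoˡ-≤ 3 (subst (ℕ._≤ n) (ℕP.*-comm 3 i) 3i≤n) ⟩
    n / 3     ∎)
    where open ℕP.≤-Reasoning

  a-as-sum : ∀ α n {m} → n ℕ.≤ m → a α n ≡ sumTo m (term α n)
  a-as-sum α n n≤m =
    sym (sumTo-extend (term α n) (ℕP.≤-trans (m/n≤m n 3) n≤m)
                      λ i n/3<i → term-vanishes α n i (/3<⇒<3* n/3<i))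

  a-rec : ∀ α n → a α (3 + n) ≡ 3 * α * a α (2 + n) + γ α * a α n
  a-rec α n = begin
    a α (3 + n)
      ≡⟨ trans (a-as-sum α (3 + n) ℕP.≤-refl) (sumTo-suc (2 + n) (term α (3 + n))) ⟩
    term α (3 + n) 0 + sumTo (2 + n) (λ i → term α (3 + n) (suc i))
      ≡⟨ cong₂ _+_ (term-rec-zero α n) (sumTo-cong (2 + n) (term-rec α n)) ⟩
    k * T₂ 0 + sumTo (2 + n) (λ i → k * T₂ (suc i) + g * T₀ i)
      ≡⟨ cong (k * T₂ 0 +_) (trans (sumTo-+ (2 + n) _ _)
                                   (cong₂ _+_ (sumTo-*ˡ (2 + n) k _) (sumTo-*ˡ (2 + n) g T₀))) ⟩
    k * T₂ 0 + (k * sumTo (2 + n) (λ i → T₂ (suc i)) + g * sumTo (2 + n) T₀)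
      ≡⟨ regroup k (T₂ 0) (sumTo (2 + n) (λ i → T₂ (suc i))) (g * sumTo (2 + n) T₀) ⟩
    k * (T₂ 0 + sumTo (2 + n) (λ i → T₂ (suc i))) + g * sumTo (2 + n) T₀
      ≡⟨ cong₂ (λ p q → k * p + g * q) (trans (a-as-sum α (2 + n) (ℕP.n≤1+n _)) (sumTo-suc (2 + n) T₂))
                                        (a-as-sum α n (ℕP.m≤n+m n 2)) ⟨
    k * a α (2 + n) + g * a α n ∎
    where
    open ≡-Reasoning
    k : ℕ
    k = 3 * α
    g : ℕ
    g = γ α
    T₂ T₀ : ℕ → ℕ
    T₂ = term α (2 + n)
    T₀ = term α n
    regroup : ∀ k p q s → k * p + (k * q + s) ≡ k * (p + q) + s
    regroup = solve-∀

  a-grows : ∀ α n → 3 * α * a α n ℕ.≤ a α (suc n)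
  a-grows α 0             = ℕP.≤-reflexive (a₁ α)
    where
    a₁ : ∀ α → 3 * α * 1 ≡ 1 * 3 * (α * 1) * 1
    a₁ = solve-∀
  a-grows α 1             = ℕP.≤-reflexive (a₂ α)
    where
    a₂ : ∀ α → 3 * α * (1 * 3 * (α * 1) * 1) ≡ 1 * (3 * 3) * (α * (α * 1)) * 1
    a₂ = solve-∀
  a-grows α (suc (suc n)) = subst (3 * α * a α (2 + n) ℕ.≤_) (sym (a-rec α n)) (ℕP.m≤m+n _ _)

  a-pos : ∀ {α} → 1 ℕ.≤ α → ∀ n → 0 ℕ.< a α n
  a-pos 1≤α zero    = ℕP.≤-refl
  a-pos 1≤α (suc n) =
    ℕP.<-≤-trans (ℕP.*-mono-< (ℕP.*-mono-≤ {1} {3} (s≤s z≤n) 1≤α) (a-pos 1≤α n)) (a-grows _ n)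

module Ratios where

  open import Level using (0ℓ)
  open import Function using (_∘_)
  open import Data.Nat as ℕ using (ℕ; zero; suc; s≤s; z≤n)
  import Data.Nat.Properties as ℕP
  import Data.Nat.Coprimality as Coprime
  open import Data.Nat.GeneralisedArithmetic using (iterate)
  open import Data.Integer as ℤ using (-[1+_])
  import Data.Integer.Properties as ℤP
  open import Data.Integer.Tactic.RingSolver using () renaming (solve-∀ to ℤ-solve-∀)
  open import Data.Rational as ℚ using (ℚ; mkℚ; 0ℚ; 1ℚ; _<_; _≤_; _+_; _*_; _-_; -_; *≤*; *<*)
  import Data.Rational.Properties as ℚP
  open import Data.Rational.Unnormalised as ℚᵘ using (mkℚᵘ; *≡*)
  import Data.Rational.Unnormalised.Properties as ℚᵘP
  open import Data.Product using (∃; _,_; _×_; proj₁; proj₂)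
  open import Data.Sum using (_⊎_; inj₁; inj₂)
  open import Data.Empty using (⊥-elim)
  open import Relation.Nullary using (Dec; yes; no)
  open import Relation.Nullary.Decidable using (dec⇒maybe)
  open import Relation.Binary.PropositionalEquality
  open import Tactic.RingSolver using (solve-∀)
  import Tactic.RingSolver.Core.AlmostCommutativeRing as ACR

  open Coefficients using (γ; a-rec; a-grows; a-pos)

  ℚ-ring : ACR.AlmostCommutativeRing 0ℓ 0ℓ
  ℚ-ring = ACR.fromCommutativeRing ℚP.+-*-commutativeRing (λ p → dec⇒maybe (0ℚ ℚP.≟ p))

  toℚᵘ-⟦⟧ : ∀ n → ℚ.toℚᵘ ⟦ n ⟧ ℚᵘ.≃ mkℚᵘ (ℤ.+ n) 0
  toℚᵘ-⟦⟧ n = ℚP.toℚᵘ-fromℚᵘ (mkℚᵘ (ℤ.+ n) 0)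

  ⟦⟧-+ : ∀ m n → ⟦ m ℕ.+ n ⟧ ≡ ⟦ m ⟧ + ⟦ n ⟧
  ⟦⟧-+ m n = ℚP.toℚᵘ-injective (begin
    ℚ.toℚᵘ ⟦ m ℕ.+ n ⟧              ≈⟨ toℚᵘ-⟦⟧ (m ℕ.+ n) ⟩
    mkℚᵘ (ℤ.+ m ℤ.+ ℤ.+ n) 0            ≈⟨ *≡* (unit (ℤ.+ m) (ℤ.+ n)) ⟩
    mkℚᵘ (ℤ.+ m) 0 ℚᵘ.+ mkℚᵘ (ℤ.+ n) 0  ≈⟨ ℚᵘP.+-cong (toℚᵘ-⟦⟧ m) (toℚᵘ-⟦⟧ n) ⟨
    ℚ.toℚᵘ ⟦ m ⟧ ℚᵘ.+ ℚ.toℚᵘ ⟦ n ⟧  ≈⟨ ℚP.toℚᵘ-homo-+ ⟦ m ⟧ ⟦ n ⟧ ⟨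
    ℚ.toℚᵘ (⟦ m ⟧ + ⟦ n ⟧)          ∎)
    where
    open ℚᵘP.≃-Reasoning
    unit : ∀ i j → (i ℤ.+ j) ℤ.* ℤ.+ 1 ≡ (i ℤ.* ℤ.+ 1 ℤ.+ j ℤ.* ℤ.+ 1) ℤ.* ℤ.+ 1
    unit = ℤ-solve-∀

  ⟦⟧-* : ∀ m n → ⟦ m ℕ.* n ⟧ ≡ ⟦ m ⟧ * ⟦ n ⟧
  ⟦⟧-* m n = ℚP.toℚᵘ-injective (begin
    ℚ.toℚᵘ ⟦ m ℕ.* n ⟧              ≈⟨ toℚᵘ-⟦⟧ (m ℕ.* n) ⟩
    mkℚᵘ (ℤ.+ (m ℕ.* n)) 0            ≡⟨ cong (λ i → mkℚᵘ i 0) (ℤP.pos-* m n) ⟩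
    mkℚᵘ (ℤ.+ m) 0 ℚᵘ.* mkℚᵘ (ℤ.+ n) 0  ≈⟨ ℚᵘP.*-cong (toℚᵘ-⟦⟧ m) (toℚᵘ-⟦⟧ n) ⟨
    ℚ.toℚᵘ ⟦ m ⟧ ℚᵘ.* ℚ.toℚᵘ ⟦ n ⟧  ≈⟨ ℚP.toℚᵘ-homo-* ⟦ m ⟧ ⟦ n ⟧ ⟨
    ℚ.toℚᵘ (⟦ m ⟧ * ⟦ n ⟧)          ∎)
    where open ℚᵘP.≃-Reasoning

  ⟦⟧≡mkℚ : ∀ n → ⟦ n ⟧ ≡ mkℚ (ℤ.+ n) 0 (Coprime.sym (Coprime.1-coprimeTo n))
  ⟦⟧≡mkℚ n = ℚP.normalize-coprime (Coprime.sym (Coprime.1-coprimeTo n))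

  ⟦⟧-mono-≤ : ∀ {m n} → m ℕ.≤ n → ⟦ m ⟧ ≤ ⟦ n ⟧
  ⟦⟧-mono-≤ {m} {n} m≤n rewrite ⟦⟧≡mkℚ m | ⟦⟧≡mkℚ n = *≤* (ℤP.*-monoʳ-≤-nonNeg (ℤ.+ 1) (ℤ.+≤+ m≤n))

  ⟦⟧-mono-< : ∀ {m n} → m ℕ.< n → ⟦ m ⟧ < ⟦ n ⟧
  ⟦⟧-mono-< {m} {n} m<n rewrite ⟦⟧≡mkℚ m | ⟦⟧≡mkℚ n = *<* (ℤP.*-monoʳ-<-pos (ℤ.+ 1) (ℤ.+<+ m<n))

  p≤q⇒0≤q-p : ∀ {p q} → p ≤ q → 0ℚ ≤ q - p
  p≤q⇒0≤q-p {p} {q} p≤q = subst (_≤ q - p) (ℚP.+-inverseʳ p) (ℚP.+-monoˡ-≤ (- p) p≤q)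

  p<q⇒0<q-p : ∀ {p q} → p < q → 0ℚ < q - p
  p<q⇒0<q-p {p} {q} p<q = subst (_< q - p) (ℚP.+-inverseʳ p) (ℚP.+-monoˡ-< (- p) p<q)

  p+[q-p]≡q : ∀ p q → p + (q - p) ≡ q
  p+[q-p]≡q = solve-∀ ℚ-ring

  0≤q-p⇒p≤q : ∀ {p q} → 0ℚ ≤ q - p → p ≤ q
  0≤q-p⇒p≤q {p} {q} 0≤q-p = subst₂ _≤_ (ℚP.+-identityʳ p) (p+[q-p]≡q p q) (ℚP.+-monoʳ-≤ p 0≤q-p)

  0<q-p⇒p<q : ∀ {p q} → 0ℚ < q - p → p < q
  0<q-p⇒p<q {p} {q} 0<q-p = subst₂ _<_ (ℚP.+-identityʳ p) (p+[q-p]≡q p q) (ℚP.+-monoʳ-< p 0<q-p)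

  ≤-rearrange : ∀ {p q p′ q′} → q - p ≡ q′ - p′ → p ≤ q → p′ ≤ q′
  ≤-rearrange eq p≤q = 0≤q-p⇒p≤q (subst (0ℚ ≤_) eq (p≤q⇒0≤q-p p≤q))

  <-rearrange : ∀ {p q p′ q′} → q - p ≡ q′ - p′ → p < q → p′ < q′
  <-rearrange eq p<q = 0<q-p⇒p<q (subst (0ℚ <_) eq (p<q⇒0<q-p p<q))

  *-nonNeg : ∀ {p q} → 0ℚ ≤ p → 0ℚ ≤ q → 0ℚ ≤ p * q
  *-nonNeg {p} {q} 0≤p 0≤q =
    ℚP.nonNegative⁻¹ (p * q) {{ℚP.nonNeg*nonNeg⇒nonNeg p {{ℚ.nonNegative 0≤p}} q {{ℚ.nonNegative 0≤q}}}}

  *-pos : ∀ {p q} → 0ℚ < p → 0ℚ < q → 0ℚ < p * q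
  *-pos {p} {q} 0<p 0<q = ℚP.positive⁻¹ (p * q) {{ℚP.pos*pos⇒pos p {{ℚ.positive 0<p}} q {{ℚ.positive 0<q}}}}

  +-nonNeg : ∀ {p q} → 0ℚ ≤ p → 0ℚ ≤ q → 0ℚ ≤ p + q
  +-nonNeg = ℚP.+-mono-≤

  +-pos : ∀ {p q} → 0ℚ < p → 0ℚ ≤ q → 0ℚ < p + q
  +-pos = ℚP.+-mono-<-≤

  0≤1 : 0ℚ ≤ 1ℚ
  0≤1 = ℚP.<⇒≤ (ℚP.positive⁻¹ 1ℚ)

  p*p-nonNeg : ∀ p → 0ℚ ≤ p * p
  p*p-nonNeg p with ℚP.≤-total 0ℚ p
  ... | inj₁ 0≤p = *-nonNeg 0≤p 0≤p
  ... | inj₂ p≤0 =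
    ℚP.nonNegative⁻¹ (p * p) {{ℚP.nonPos*nonPos⇒nonPos p {{ℚ.nonPositive p≤0}} p {{ℚ.nonPositive p≤0}}}}

  *-monoˡ-≤ : ∀ {r p q} → 0ℚ ≤ r → p ≤ q → r * p ≤ r * q
  *-monoˡ-≤ {r} 0≤r = ℚP.*-monoˡ-≤-nonNeg r {{ℚ.nonNegative 0≤r}}

  *-monoʳ-≤ : ∀ {r p q} → 0ℚ ≤ r → p ≤ q → p * r ≤ q * r
  *-monoʳ-≤ {r} 0≤r = ℚP.*-monoʳ-≤-nonNeg r {{ℚ.nonNegative 0≤r}}

  *-monoʳ-< : ∀ {r p q} → 0ℚ < r → p < q → p * r < q * r
  *-monoʳ-< {r} 0<r = ℚP.*-monoˡ-<-pos r {{ℚ.positive 0<r}}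

  *-cancelʳ-≤ : ∀ {r p q} → 0ℚ < r → p * r ≤ q * r → p ≤ q
  *-cancelʳ-≤ {r} 0<r = ℚP.*-cancelʳ-≤-pos r {{ℚ.positive 0<r}}

  *-cancelʳ-< : ∀ {r p q} → 0ℚ ≤ r → p * r < q * r → p < q
  *-cancelʳ-< {r} 0≤r = ℚP.*-cancelʳ-<-nonNeg r {{ℚ.nonNegative 0≤r}}

  *-mono-≤ : ∀ {p q r s} → 0ℚ ≤ p → 0ℚ ≤ r → p ≤ q → r ≤ s → p * r ≤ q * s
  *-mono-≤ 0≤p 0≤r p≤q r≤s = ℚP.≤-trans (*-monoʳ-≤ 0≤r p≤q) (*-monoˡ-≤ (ℚP.≤-trans 0≤p p≤q) r≤s)

  cube-mono-≤ : ∀ {p q} → 0ℚ ≤ p → p ≤ q → p * p * p ≤ q * q * q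
  cube-mono-≤ 0≤p p≤q = *-mono-≤ (*-nonNeg 0≤p 0≤p) 0≤p (*-mono-≤ 0≤p 0≤p p≤q p≤q) p≤q

  recip : (p : ℚ) → .(0ℚ < p) → ℚ
  recip p 0<p = ℚ.1/_ p {{ℚ.>-nonZero 0<p}}

  *-recip : ∀ {p} (0<p : 0ℚ < p) → p * recip p 0<p ≡ 1ℚ
  *-recip {p} 0<p = ℚP.*-inverseʳ p {{ℚ.>-nonZero 0<p}}

  recip-pos : ∀ {p} (0<p : 0ℚ < p) → 0ℚ < recip p 0<p
  recip-pos {p} 0<p = ℚP.positive⁻¹ _ {{ℚP.1/pos⇒pos p {{ℚ.positive 0<p}}}}

  *-recip-cancel : ∀ {p} (0<p : 0ℚ < p) q → q * p * recip p 0<p ≡ q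
  *-recip-cancel {p} 0<p q = begin
    q * p * recip p 0<p   ≡⟨ ℚP.*-assoc q p _ ⟩
    q * (p * recip p 0<p) ≡⟨ cong (q *_) (*-recip 0<p) ⟩
    q * 1ℚ                ≡⟨ ℚP.*-identityʳ q ⟩
    q                     ∎
    where open ≡-Reasoning

  recip-*-cancel : ∀ {p} (0<p : 0ℚ < p) q → q * recip p 0<p * p ≡ q
  recip-*-cancel {p} 0<p q = trans (shuffle q (recip p 0<p) p) (*-recip-cancel 0<p q)
    where
    shuffle : ∀ q i p → q * i * p ≡ q * p * i
    shuffle = solve-∀ ℚ-ring

  *≤⇒≤*recip : ∀ {p q r} (0<r : 0ℚ < r) → p * r ≤ q → p ≤ q * recip r 0<r
  *≤⇒≤*recip {p} {q} 0<r pr≤q =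
    subst (_≤ q * recip _ 0<r) (*-recip-cancel 0<r p) (*-monoʳ-≤ (ℚP.<⇒≤ (recip-pos 0<r)) pr≤q)

  ≤*⇒*recip≤ : ∀ {p q r} (0<r : 0ℚ < r) → q ≤ p * r → q * recip r 0<r ≤ p
  ≤*⇒*recip≤ {p} {q} 0<r q≤pr =
    subst (q * recip _ 0<r ≤_) (*-recip-cancel 0<r p) (*-monoʳ-≤ (ℚP.<⇒≤ (recip-pos 0<r)) q≤pr)

  *<⇒<*recip : ∀ {p q r} (0<r : 0ℚ < r) → p * r < q → p < q * recip r 0<r
  *<⇒<*recip {p} {q} 0<r pr<q =
    subst (_< q * recip _ 0<r) (*-recip-cancel 0<r p) (*-monoʳ-< (recip-pos 0<r) pr<q)

  <*⇒*recip< : ∀ {p q r} (0<r : 0ℚ < r) → q < p * r → q * recip r 0<r < p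
  <*⇒*recip< {p} {q} 0<r q<pr =
    subst (q * recip _ 0<r <_) (*-recip-cancel 0<r p) (*-monoʳ-< (recip-pos 0<r) q<pr)

  <*recip⇒*< : ∀ {p q r} (0<r : 0ℚ < r) → p < q * recip r 0<r → p * r < q
  <*recip⇒*< {p} {q} 0<r p<q/r = subst (p * _ <_) (recip-*-cancel 0<r q) (*-monoʳ-< 0<r p<q/r)

  *recip<⇒<* : ∀ {p q r} (0<r : 0ℚ < r) → q * recip r 0<r < p → q < p * r
  *recip<⇒<* {p} {q} 0<r q/r<p = subst (_< p * _) (recip-*-cancel 0<r q) (*-monoʳ-< 0<r q/r<p)

  recip-antitone : ∀ {p q} (0<p : 0ℚ < p) (0<q : 0ℚ < q) → p ≤ q → recip q 0<q ≤ recip p 0<p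
  recip-antitone {p} {q} 0<p 0<q p≤q = begin
    recip q 0<q      ≤⟨ *≤⇒≤*recip 0<p q⁻¹p≤1 ⟩
    1ℚ * recip p 0<p ≡⟨ ℚP.*-identityˡ _ ⟩
    recip p 0<p      ∎
    where
    open ℚP.≤-Reasoning
    q⁻¹p≤1 : recip q 0<q * p ≤ 1ℚ
    q⁻¹p≤1 = begin
      recip q 0<q * p ≡⟨ ℚP.*-comm _ p ⟩
      p * recip q 0<q ≤⟨ *-monoʳ-≤ (ℚP.<⇒≤ (recip-pos 0<q)) p≤q ⟩
      q * recip q 0<q ≡⟨ *-recip 0<q ⟩
      1ℚ              ∎

  recip-swap-< : ∀ D {u v} (0<u : 0ℚ < u) (0<v : 0ℚ < v) → v < D * recip u 0<u → u < D * recip v 0<v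
  recip-swap-< D {u} {v} 0<u 0<v v<D/u = *<⇒<*recip 0<v (subst (_< D) (ℚP.*-comm v u) (<*recip⇒*< 0<u v<D/u))

  recip-swap-> : ∀ D {u v} (0<u : 0ℚ < u) (0<v : 0ℚ < v) → D * recip u 0<u < v → D * recip v 0<v < u
  recip-swap-> D {u} {v} 0<u 0<v D/u<v = <*⇒*recip< 0<v (subst (D <_) (ℚP.*-comm v u) (*recip<⇒<* 0<u D/u<v))

  archimedean : ∀ p {δ} → 0ℚ < δ → ∃ λ n → p < ⟦ n ⟧ * δ
  archimedean p {δ} 0<δ =
    let n , p/δ<n = below-⟦⟧ (p * recip δ 0<δ)
    in n , subst (_< ⟦ n ⟧ * δ) (recip-*-cancel 0<δ p) (*-monoʳ-< 0<δ p/δ<n)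
    where
    below-⟦⟧ : ∀ p → ∃ λ n → p < ⟦ n ⟧
    below-⟦⟧ p@(mkℚ -[1+ _ ] _ _) = 0 , ℚP.negative⁻¹ p
    below-⟦⟧ p@(mkℚ (ℤ.+ m) d _)  = suc m , subst (p <_) (sym (⟦⟧≡mkℚ (suc m)))
      (*<* (subst₂ ℤ._<_ (ℤP.pos-* m 1) (ℤP.pos-* (suc m) (suc d)) (ℤ.+<+ m*1<[1+m]*[1+d])))
      where
      m*1<[1+m]*[1+d] : m ℕ.* 1 ℕ.< suc m ℕ.* suc d
      m*1<[1+m]*[1+d] =
        ℕP.<-≤-trans (ℕP.≤-reflexive (cong suc (ℕP.*-identityʳ m))) (ℕP.m≤m*n (suc m) (suc d))

  descends-below : ∀ {X : Set} (f : X → X) (w : X → ℚ) {ε δ} → 0ℚ < δ → (∀ y → 0ℚ ≤ w y) →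
                   (∀ y → ε ≤ w y → w (f y) ≤ w y - δ) → ∀ y → ∃ λ i → w (iterate f y i) < ε
  descends-below f w {ε} {δ} 0<δ w≥0 step y = conclude (archimedean (w y) 0<δ)
    where
    descent : ∀ n y → (∃ λ i → w (iterate f y i) < ε) ⊎ (w (iterate f y n) ≤ w y - ⟦ n ⟧ * δ)
    descent zero    y = inj₂ (ℚP.≤-reflexive (minus-zero (w y) δ))
      where
      minus-zero : ∀ p δ → p ≡ p - 0ℚ * δ
      minus-zero = solve-∀ ℚ-ring
    descent (suc n) y with w y ℚP.<? ε
    ... | yes wy<ε = inj₁ (0 , wy<ε)
    ... | no  wy≮ε with descent n (f y)
    ...   | inj₁ (i , small) = inj₁ (suc i , small)
    ...   | inj₂ bound = inj₂ (begin
      w (iterate f (f y) n)      ≤⟨ bound ⟩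
      w (f y) - ⟦ n ⟧ * δ        ≤⟨ ℚP.+-monoˡ-≤ (- (⟦ n ⟧ * δ)) (step y (ℚP.≮⇒≥ wy≮ε)) ⟩
      w y - δ - ⟦ n ⟧ * δ        ≡⟨ regroup (w y) ⟦ n ⟧ δ ⟩
      w y - (1ℚ + ⟦ n ⟧) * δ     ≡⟨ cong (λ m → w y - m * δ) (⟦⟧-+ 1 n) ⟨
      w y - ⟦ suc n ⟧ * δ        ∎)
      where
      open ℚP.≤-Reasoning
      regroup : ∀ p m δ → p - δ - m * δ ≡ p - (1ℚ + m) * δ
      regroup = solve-∀ ℚ-ring
    conclude : (∃ λ n → w y < ⟦ n ⟧ * δ) → ∃ λ i → w (iterate f y i) < ε
    conclude (n , wy<nδ) with descent n y
    ... | inj₁ found = found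
    ... | inj₂ bound = ⊥-elim (ℚP.<-irrefl refl (ℚP.<-≤-trans wy<nδ (0≤q-p⇒p≤q (ℚP.≤-trans (w≥0 _) bound))))

  small-factor : ∀ {G M} → 0ℚ < G → 0ℚ ≤ M → ∃ λ w → 0ℚ < w × w ≤ 1ℚ × w * M < G
  small-factor {G} {M} 0<G 0≤M = G * i , *-pos 0<G (recip-pos 0<G+M) , w≤1 , wM<G
    where
    open ≡-Reasoning
    0<G+M : 0ℚ < G + M
    0<G+M = +-pos 0<G 0≤M
    i : ℚ
    i = recip (G + M) 0<G+M
    w≤1 : G * i ≤ 1ℚ
    w≤1 = 0≤q-p⇒p≤q (subst (0ℚ ≤_) (sym (begin
      1ℚ - G * i            ≡⟨ cong (_- G * i) (*-recip 0<G+M) ⟨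
      (G + M) * i - G * i   ≡⟨ split G M i ⟩
      M * i                 ∎)) (*-nonNeg 0≤M (ℚP.<⇒≤ (recip-pos 0<G+M))))
      where
      split : ∀ G M i → (G + M) * i - G * i ≡ M * i
      split = solve-∀ ℚ-ring
    wM<G : G * i * M < G
    wM<G = 0<q-p⇒p<q (subst (0ℚ <_) (sym (begin
      G - G * i * M               ≡⟨ cong (λ g → g - G * i * M) (ℚP.*-identityʳ G) ⟨
      G * 1ℚ - G * i * M          ≡⟨ cong (λ u → G * u - G * i * M) (*-recip 0<G+M) ⟨
      G * ((G + M) * i) - G * i * M ≡⟨ split G M i ⟩
      G * G * i                   ∎)) (*-pos (*-pos 0<G 0<G) (recip-pos 0<G+M)))
      where
      split : ∀ G M i → G * ((G + M) * i) - G * i * M ≡ G * G * i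
      split = solve-∀ ℚ-ring

  cubic : ℚ → ℚ → ℚ
  cubic k t = (t - k) * t * t

  cubic-mono : ∀ {k s t} → 0ℚ ≤ k → k ≤ s → s ≤ t → cubic k s ≤ cubic k t
  cubic-mono {k} {s} {t} 0≤k k≤s s≤t = begin
    (s - k) * s * s ≤⟨ *-monoʳ-≤ 0≤s (*-monoʳ-≤ 0≤s (ℚP.+-monoˡ-≤ (- k) s≤t)) ⟩
    (t - k) * s * s ≤⟨ *-monoʳ-≤ 0≤s (*-monoˡ-≤ 0≤t-k s≤t) ⟩
    (t - k) * t * s ≤⟨ *-monoˡ-≤ (*-nonNeg 0≤t-k (ℚP.≤-trans 0≤s s≤t)) s≤t ⟩
    (t - k) * t * t ∎
    where
    open ℚP.≤-Reasoning
    0≤s : 0ℚ ≤ s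
    0≤s = ℚP.≤-trans 0≤k k≤s
    0≤t-k : 0ℚ ≤ t - k
    0≤t-k = p≤q⇒0≤q-p (ℚP.≤-trans k≤s s≤t)

  c<cubic⇒k< : ∀ {k c} s → 0ℚ ≤ c → c < cubic k s → k < s
  c<cubic⇒k< {k} {c} s 0≤c c<g =
    ℚP.≰⇒> λ s≤k → ℚP.<-irrefl refl (ℚP.<-≤-trans c<g (ℚP.≤-trans (g≤0 s≤k) 0≤c))
    where
    flip : ∀ k s → (k - s) * (s * s) - 0ℚ ≡ 0ℚ - (s - k) * s * s
    flip = solve-∀ ℚ-ring
    g≤0 : s ≤ k → cubic k s ≤ 0ℚ
    g≤0 s≤k = ≤-rearrange (flip k s) (*-nonNeg (p≤q⇒0≤q-p s≤k) (p*p-nonNeg s))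

  cubic-gap-above : ∀ {k c} s → 0ℚ ≤ k → k ≤ s → cubic k s < c → ∃ λ w → 0ℚ < w × cubic k (s + w) < c
  cubic-gap-above {k} {c} s 0≤k k≤s g<c = conclude (small-factor (p<q⇒0<q-p g<c) 0≤M)
    where
    0≤s : 0ℚ ≤ s
    0≤s = ℚP.≤-trans 0≤k k≤s
    M : ℚ
    M = (s - k) * (s + s + 1ℚ) + (s + 1ℚ) * (s + 1ℚ)
    0≤M : 0ℚ ≤ M
    0≤M = +-nonNeg (*-nonNeg (p≤q⇒0≤q-p k≤s) (+-nonNeg (+-nonNeg 0≤s 0≤s) 0≤1)) (p*p-nonNeg (s + 1ℚ))
    expand : ∀ c k s w → c - (s + w - k) * (s + w) * (s + w) ≡
      (c - (s - k) * s * s) - w * ((s - k) * (s + s + 1ℚ) + (s + 1ℚ) * (s + 1ℚ))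
        + w * (1ℚ - w) * ((s - k) + (s + s + 1ℚ + w))
    expand = solve-∀ ℚ-ring
    conclude : (∃ λ w → 0ℚ < w × w ≤ 1ℚ × w * M < c - cubic k s) → ∃ λ w → 0ℚ < w × cubic k (s + w) < c
    conclude (w , 0<w , w≤1 , wM<G) = w , 0<w , 0<q-p⇒p<q (subst (0ℚ <_) (sym (expand c k s w))
      (+-pos (p<q⇒0<q-p wM<G) (*-nonNeg (*-nonNeg 0≤w (p≤q⇒0≤q-p w≤1))
         (+-nonNeg (p≤q⇒0≤q-p k≤s) (+-nonNeg (+-nonNeg (+-nonNeg 0≤s 0≤s) 0≤1) 0≤w)))))
      where
      0≤w : 0ℚ ≤ w
      0≤w = ℚP.<⇒≤ 0<w

  cubic-gap-below : ∀ {k c} s → 1ℚ ≤ k → k < s → c < cubic k s → ∃ λ w → 0ℚ < w × c < cubic k (s - w)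
  cubic-gap-below {k} {c} s 1≤k k<s c<g = conclude (small-factor (p<q⇒0<q-p c<g) 0≤M)
    where
    1≤s : 1ℚ ≤ s
    1≤s = ℚP.≤-trans 1≤k (ℚP.<⇒≤ k<s)
    0≤s : 0ℚ ≤ s
    0≤s = ℚP.≤-trans 0≤1 1≤s
    0≤s-k : 0ℚ ≤ s - k
    0≤s-k = ℚP.<⇒≤ (p<q⇒0<q-p k<s)
    M : ℚ
    M = (s + s) * (s - k) + s * s
    0≤M : 0ℚ ≤ M
    0≤M = +-nonNeg (*-nonNeg (+-nonNeg 0≤s 0≤s) 0≤s-k) (p*p-nonNeg s)
    expand : ∀ c k s w → (s - w - k) * (s - w) * (s - w) - c ≡
      ((s - k) * s * s - c) - w * ((s + s) * (s - k) + s * s) + ((s - k) * (w * w) + w * w * (s + (s - w)))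
    expand = solve-∀ ℚ-ring

    conclude : (∃ λ w → 0ℚ < w × w ≤ 1ℚ × w * M < cubic k s - c) → ∃ λ w → 0ℚ < w × c < cubic k (s - w)
    conclude (w , 0<w , w≤1 , wM<G) = w , 0<w , 0<q-p⇒p<q (subst (0ℚ <_) (sym (expand c k s w))
      (+-pos (p<q⇒0<q-p wM<G) (+-nonNeg (*-nonNeg 0≤s-k (p*p-nonNeg w))
         (*-nonNeg (p*p-nonNeg w) (+-nonNeg 0≤s (p≤q⇒0≤q-p (ℚP.≤-trans w≤1 1≤s)))))))
  Eventually : (ℕ → Set) → Set
  Eventually P = ∃ λ N → ∀ n → N ℕ.≤ n → P n

  eventually-× : ∀ {P Q : ℕ → Set} → Eventually P → Eventually Q → Eventually (λ n → P n × Q n)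
  eventually-× (M , P≥M) (N , Q≥N) =
    M ℕ.+ N , λ n M+N≤n → P≥M n (ℕP.≤-trans (ℕP.m≤m+n M N) M+N≤n)
                        , Q≥N n (ℕP.≤-trans (ℕP.m≤n+m N M) M+N≤n)

  module Recurrent (k c : ℚ) (A : ℕ → ℚ) (1≤k : 1ℚ ≤ k) (0≤c : 0ℚ ≤ c)
                   (A-pos : ∀ n → 0ℚ < A n) (A-grows : ∀ n → k * A n ≤ A (suc n))
                   (A-rec : ∀ n → A (3 ℕ.+ n) ≡ k * A (2 ℕ.+ n) + c * A n) where

    0<k : 0ℚ < k
    0<k = ℚP.<-≤-trans (ℚP.positive⁻¹ 1ℚ) 1≤k

    0≤k : 0ℚ ≤ k
    0≤k = ℚP.<⇒≤ 0<k

    0≤A : ∀ n → 0ℚ ≤ A n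
    0≤A n = ℚP.<⇒≤ (A-pos n)

    A-mono : ∀ n → A n ≤ A (suc n)
    A-mono n = begin
      A n       ≡⟨ ℚP.*-identityˡ (A n) ⟨
      1ℚ * A n  ≤⟨ *-monoʳ-≤ (0≤A n) 1≤k ⟩
      k * A n   ≤⟨ A-grows n ⟩
      A (suc n) ∎
      where open ℚP.≤-Reasoning

    ρ : ℕ → ℚ
    ρ n = A (suc n) * recip (A n) (A-pos n)

    k≤ρ : ∀ n → k ≤ ρ n
    k≤ρ n = *≤⇒≤*recip (A-pos n) (A-grows n)

    Bracket : ℚ → ℚ → ℕ → Set
    Bracket l u n = l * A n ≤ A (suc n) × A (suc n) ≤ u * A n

    record Box : Set where
      field
        from    : ℕ
        lo hi   : ℚ
        k≤lo    : k ≤ lo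
        lo≤hi   : lo ≤ hi
        bracket : ∀ n → from ℕ.≤ n → Bracket lo hi n

    open Box

    width : Box → ℚ
    width b = hi b - lo b

    lo≤ρ≤hi : ∀ b n → from b ℕ.≤ n → lo b ≤ ρ n × ρ n ≤ hi b
    lo≤ρ≤hi b n from≤n = *≤⇒≤*recip (A-pos n) (proj₁ br) , ≤*⇒*recip≤ (A-pos n) (proj₂ br)
      where
      br : Bracket (lo b) (hi b) n
      br = bracket b n from≤n

    initial : Box
    initial = record
      { from = 2 ; lo = k ; hi = k + c ; k≤lo = ℚP.≤-refl
      ; lo≤hi = subst (_≤ k + c) (ℚP.+-identityʳ k) (ℚP.+-monoʳ-≤ k 0≤c)
      ; bracket = λ { (suc (suc m)) (s≤s (s≤s _)) → A-grows (2 ℕ.+ m) , upper m }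
      }
      where
      upper : ∀ m → A (3 ℕ.+ m) ≤ (k + c) * A (2 ℕ.+ m)
      upper m = begin
        A (3 ℕ.+ m)                        ≡⟨ A-rec m ⟩
        k * A (2 ℕ.+ m) + c * A m
          ≤⟨ ℚP.+-monoʳ-≤ (k * A (2 ℕ.+ m)) (*-monoˡ-≤ 0≤c (ℚP.≤-trans (A-mono m) (A-mono (suc m)))) ⟩
        k * A (2 ℕ.+ m) + c * A (2 ℕ.+ m)  ≡⟨ ℚP.*-distribʳ-+ (A (2 ℕ.+ m)) k c ⟨
        (k + c) * A (2 ℕ.+ m)              ∎
        where open ℚP.≤-Reasoning

    0<k³+c : 0ℚ < k * k * k + c
    0<k³+c = +-pos (*-pos (*-pos 0<k 0<k) 0<k) 0≤c

    θ₀ : ℚ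
    θ₀ = c * recip (k * k * k + c) 0<k³+c

    module Refine (b : Box) where

      l : ℚ
      l = lo b
      u : ℚ
      u = hi b
      0<l : 0ℚ < l
      0<l = ℚP.<-≤-trans 0<k (k≤lo b)
      0<u : 0ℚ < u
      0<u = ℚP.<-≤-trans 0<l (lo≤hi b)
      K : ℚ
      K = k * l * u + c
      0<K : 0ℚ < K
      0<K = +-pos (*-pos (*-pos 0<k 0<l) 0<u) 0≤c
      θ : ℚ
      θ = c * recip K 0<K
      0≤θ : 0ℚ ≤ θ
      0≤θ = *-nonNeg 0≤c (ℚP.<⇒≤ (recip-pos 0<K))

      l′ u′ : ℚ
      l′ = k + θ * l
      u′ = k + θ * u

      θK-cancel : ∀ p → θ * (K * p) ≡ c * p
      θK-cancel p = trans (sym (ℚP.*-assoc θ K p)) (cong (_* p) (recip-*-cancel 0<K c))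

      l*A₃≤K*A₁ : ∀ m → from b ℕ.≤ m → l * A (3 ℕ.+ m) ≤ K * A (1 ℕ.+ m)
      l*A₃≤K*A₁ m from≤m = begin
        l * A (3 ℕ.+ m)                              ≡⟨ cong (l *_) (A-rec m) ⟩
        l * (k * A (2 ℕ.+ m) + c * A m)              ≡⟨ spread l k c (A (2 ℕ.+ m)) (A m) ⟩
        k * l * A (2 ℕ.+ m) + c * (l * A m)          ≤⟨ ℚP.+-mono-≤ (*-monoˡ-≤ (*-nonNeg 0≤k (ℚP.<⇒≤ 0<l)) upper₁)
                                                                     (*-monoˡ-≤ 0≤c lower₀) ⟩
        k * l * (u * A (1 ℕ.+ m)) + c * A (1 ℕ.+ m)  ≡⟨ collect k l u c (A (1 ℕ.+ m)) ⟩
        K * A (1 ℕ.+ m)                              ∎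
        where
        open ℚP.≤-Reasoning
        lower₀ : l * A m ≤ A (1 ℕ.+ m)
        lower₀ = proj₁ (bracket b m from≤m)
        upper₁ : A (2 ℕ.+ m) ≤ u * A (1 ℕ.+ m)
        upper₁ = proj₂ (bracket b (suc m) (ℕP.≤-trans from≤m (ℕP.n≤1+n m)))
        spread : ∀ l k c p q → l * (k * p + c * q) ≡ k * l * p + c * (l * q)
        spread = solve-∀ ℚ-ring
        collect : ∀ k l u c p → k * l * (u * p) + c * p ≡ (k * l * u + c) * p
        collect = solve-∀ ℚ-ring

      K*A₁≤u*A₃ : ∀ m → from b ℕ.≤ m → K * A (1 ℕ.+ m) ≤ u * A (3 ℕ.+ m)
      K*A₁≤u*A₃ m from≤m = begin
        K * A (1 ℕ.+ m)                              ≡⟨ spread k l u c (A (1 ℕ.+ m)) ⟩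
        k * u * (l * A (1 ℕ.+ m)) + c * A (1 ℕ.+ m)  ≤⟨ ℚP.+-mono-≤ (*-monoˡ-≤ (*-nonNeg 0≤k (ℚP.<⇒≤ 0<u)) lower₁)
                                                                     (*-monoˡ-≤ 0≤c upper₀) ⟩
        k * u * A (2 ℕ.+ m) + c * (u * A m)          ≡⟨ collect u k c (A (2 ℕ.+ m)) (A m) ⟩
        u * (k * A (2 ℕ.+ m) + c * A m)              ≡⟨ cong (u *_) (A-rec m) ⟨
        u * A (3 ℕ.+ m)                              ∎
        where
        open ℚP.≤-Reasoning
        upper₀ : A (1 ℕ.+ m) ≤ u * A m
        upper₀ = proj₂ (bracket b m from≤m)
        lower₁ : l * A (1 ℕ.+ m) ≤ A (2 ℕ.+ m)
        lower₁ = proj₁ (bracket b (suc m) (ℕP.≤-trans from≤m (ℕP.n≤1+n m)))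
        spread : ∀ k l u c p → (k * l * u + c) * p ≡ k * u * (l * p) + c * p
        spread = solve-∀ ℚ-ring
        collect : ∀ u k c p q → k * u * p + c * (u * q) ≡ u * (k * p + c * q)
        collect = solve-∀ ℚ-ring

      -- ρ (3 + m) = k + c A (1 + m) / A (3 + m), and A (3 + m) / A (1 + m) = k ρ (1 + m) + c / ρ m
      -- lies in [K / u, K / l].
      step : ∀ m → from b ℕ.≤ m → Bracket l′ u′ (3 ℕ.+ m)
      step m from≤m = lower , upper
        where
        open ℚP.≤-Reasoning
        A₁ A₃ : ℚ
        A₁ = A (1 ℕ.+ m)
        A₃ = A (3 ℕ.+ m)
        spread : ∀ k θ t p → (k + θ * t) * p ≡ k * p + θ * (t * p)
        spread = solve-∀ ℚ-ring
        lower : l′ * A₃ ≤ A (4 ℕ.+ m)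
        lower = begin
          l′ * A₃                 ≡⟨ spread k θ l A₃ ⟩
          k * A₃ + θ * (l * A₃)   ≤⟨ ℚP.+-monoʳ-≤ (k * A₃) (*-monoˡ-≤ 0≤θ (l*A₃≤K*A₁ m from≤m)) ⟩
          k * A₃ + θ * (K * A₁)   ≡⟨ cong (λ t → k * A₃ + t) (θK-cancel A₁) ⟩
          k * A₃ + c * A₁         ≡⟨ A-rec (suc m) ⟨
          A (4 ℕ.+ m)             ∎
        upper : A (4 ℕ.+ m) ≤ u′ * A₃
        upper = begin
          A (4 ℕ.+ m)             ≡⟨ A-rec (suc m) ⟩
          k * A₃ + c * A₁         ≡⟨ cong (λ t → k * A₃ + t) (θK-cancel A₁) ⟨
          k * A₃ + θ * (K * A₁)   ≤⟨ ℚP.+-monoʳ-≤ (k * A₃) (*-monoˡ-≤ 0≤θ (K*A₁≤u*A₃ m from≤m)) ⟩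
          k * A₃ + θ * (u * A₃)   ≡⟨ spread k θ u A₃ ⟨
          u′ * A₃                 ∎

      width′ : u′ - l′ ≡ θ * (u - l)
      width′ = shrink k θ u l
        where
        shrink : ∀ k θ u l → (k + θ * u) - (k + θ * l) ≡ θ * (u - l)
        shrink = solve-∀ ℚ-ring

      θ≤θ₀ : θ ≤ θ₀
      θ≤θ₀ = *-monoˡ-≤ 0≤c (recip-antitone 0<k³+c 0<K (ℚP.+-monoˡ-≤ c k³≤klu))
        where
        k³≤klu : k * k * k ≤ k * l * u
        k³≤klu = ℚP.≤-trans (*-monoʳ-≤ 0≤k (*-monoˡ-≤ 0≤k (k≤lo b)))
                            (*-monoˡ-≤ (*-nonNeg 0≤k (ℚP.<⇒≤ 0<l)) (ℚP.≤-trans (k≤lo b) (lo≤hi b)))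

      refined : Box
      refined = record
        { from = 3 ℕ.+ from b ; lo = l′ ; hi = u′
        ; k≤lo = subst (_≤ l′) (ℚP.+-identityʳ k) (ℚP.+-monoʳ-≤ k (*-nonNeg 0≤θ (ℚP.<⇒≤ 0<l)))
        ; lo≤hi = 0≤q-p⇒p≤q (subst (0ℚ ≤_) (sym width′) (*-nonNeg 0≤θ (p≤q⇒0≤q-p (lo≤hi b))))
        ; bracket = λ { (suc (suc (suc m))) (s≤s (s≤s (s≤s s≤m))) → step m s≤m }
        }

    refine : Box → Box
    refine = Refine.refined

    width-refine : ∀ b → width (refine b) ≤ θ₀ * width b
    width-refine b = begin
      u′ - l′      ≡⟨ width′ ⟩
      θ * (u - l)  ≤⟨ *-monoʳ-≤ (p≤q⇒0≤q-p (lo≤hi b)) θ≤θ₀ ⟩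
      θ₀ * (u - l) ∎
      where
      open Refine b
      open ℚP.≤-Reasoning

    0<1-θ₀ : 0ℚ < 1ℚ - θ₀
    0<1-θ₀ = subst (0ℚ <_) (sym (begin
      1ℚ - c * r                  ≡⟨ cong (_- c * r) (*-recip 0<k³+c) ⟨
      (k * k * k + c) * r - c * r ≡⟨ cancel (k * k * k) c r ⟩
      k * k * k * r               ∎)) (*-pos (*-pos (*-pos 0<k 0<k) 0<k) (recip-pos 0<k³+c))
      where
      open ≡-Reasoning
      r : ℚ
      r = recip (k * k * k + c) 0<k³+c
      cancel : ∀ m c r → (m + c) * r - c * r ≡ m * r
      cancel = solve-∀ ℚ-ring

    narrow : ∀ {ε} → 0ℚ < ε → ∃ λ (b : Box) → width b < ε
    narrow {ε} 0<ε =
      let i , small = descends-below refine width (*-pos 0<1-θ₀ 0<ε) (p≤q⇒0≤q-p ∘ lo≤hi) shrink initial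
      in iterate refine initial i , small
      where
      open ℚP.≤-Reasoning
      split : ∀ θ w → θ * w ≡ w - (1ℚ - θ) * w
      split = solve-∀ ℚ-ring
      shrink : ∀ b → ε ≤ width b → width (refine b) ≤ width b - (1ℚ - θ₀) * ε
      shrink b ε≤w = begin
        width (refine b)              ≤⟨ width-refine b ⟩
        θ₀ * width b                  ≡⟨ split θ₀ (width b) ⟩
        width b - (1ℚ - θ₀) * width b
          ≤⟨ ℚP.+-monoʳ-≤ (width b) (ℚP.neg-antimono-≤ (*-monoˡ-≤ (ℚP.<⇒≤ 0<1-θ₀) ε≤w)) ⟩
        width b - (1ℚ - θ₀) * ε       ∎

    lower-at : ∀ b j → lo b * A (j ℕ.+ from b) ≤ A (suc (j ℕ.+ from b))
    lower-at b j = proj₁ (bracket b (j ℕ.+ from b) (ℕP.m≤n+m (from b) j))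

    upper-at : ∀ b j → A (suc (j ℕ.+ from b)) ≤ hi b * A (j ℕ.+ from b)
    upper-at b j = proj₂ (bracket b (j ℕ.+ from b) (ℕP.m≤n+m (from b) j))

    rec-lower-bound : ∀ l n → l * A (2 ℕ.+ n) ≤ A (3 ℕ.+ n) → (l - k) * A (2 ℕ.+ n) ≤ c * A n
    rec-lower-bound l n =
      ≤-rearrange (trans (cong (_- l * A (2 ℕ.+ n)) (A-rec n)) (regroup l k c (A (2 ℕ.+ n)) (A n)))
      where
      regroup : ∀ l k c p q → k * p + c * q - l * p ≡ c * q - (l - k) * p
      regroup = solve-∀ ℚ-ring

    rec-upper-bound : ∀ u n → A (3 ℕ.+ n) ≤ u * A (2 ℕ.+ n) → c * A n ≤ (u - k) * A (2 ℕ.+ n)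
    rec-upper-bound u n =
      ≤-rearrange (trans (cong (λ t → u * A (2 ℕ.+ n) - t) (A-rec n)) (regroup u k c (A (2 ℕ.+ n)) (A n)))
      where
      regroup : ∀ u k c p q → u * p - (k * p + c * q) ≡ (u - k) * p - c * q
      regroup = solve-∀ ℚ-ring

    cubic*A : ∀ t n → cubic k t * A n ≡ (t - k) * (t * (t * A n))
    cubic*A t n = reassoc (t - k) t (A n)
      where
      reassoc : ∀ a t p → a * t * t * p ≡ a * (t * (t * p))
      reassoc = solve-∀ ℚ-ring

    cubic-lo≤c : ∀ b → cubic k (lo b) ≤ c
    cubic-lo≤c b = *-cancelʳ-≤ (A-pos n) (begin
      cubic k l * A n             ≡⟨ cubic*A l n ⟩
      (l - k) * (l * (l * A n))
        ≤⟨ *-monoˡ-≤ (p≤q⇒0≤q-p (k≤lo b)) (ℚP.≤-trans (*-monoˡ-≤ 0≤l (lower-at b 0)) (lower-at b 1)) ⟩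
      (l - k) * A (2 ℕ.+ n)       ≤⟨ rec-lower-bound l n (lower-at b 2) ⟩
      c * A n                     ∎)
      where
      open ℚP.≤-Reasoning
      n : ℕ
      n = from b
      l : ℚ
      l = lo b
      0≤l : 0ℚ ≤ l
      0≤l = ℚP.≤-trans 0≤k (k≤lo b)

    c≤cubic-hi : ∀ b → c ≤ cubic k (hi b)
    c≤cubic-hi b = *-cancelʳ-≤ (A-pos n) (begin
      c * A n                     ≤⟨ rec-upper-bound u n (upper-at b 2) ⟩
      (u - k) * A (2 ℕ.+ n)
        ≤⟨ *-monoˡ-≤ 0≤u-k (ℚP.≤-trans (upper-at b 1) (*-monoˡ-≤ 0≤u (upper-at b 0))) ⟩
      (u - k) * (u * (u * A n))   ≡⟨ cubic*A u n ⟨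
      cubic k u * A n             ∎)
      where
      open ℚP.≤-Reasoning
      n : ℕ
      n = from b
      u : ℚ
      u = hi b
      k≤u : k ≤ u
      k≤u = ℚP.≤-trans (k≤lo b) (lo≤hi b)
      0≤u-k : 0ℚ ≤ u - k
      0≤u-k = p≤q⇒0≤q-p k≤u
      0≤u : 0ℚ ≤ u
      0≤u = ℚP.≤-trans 0≤k k≤u

    below-lo : ∀ {s w} b → width b < w → cubic k (s + w) < c → s < lo b
    below-lo {s} {w} b thin g<c = 0<q-p⇒p<q (subst (0ℚ <_) (sym (split (lo b) (hi b) s w))
      (+-pos (p<q⇒0<q-p thin) (ℚP.<⇒≤ (p<q⇒0<q-p s+w<hi))))
      where
      s+w<hi : s + w < hi b
      s+w<hi = ℚP.≰⇒> λ hi≤s+w → ℚP.<-irrefl refl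
        (ℚP.<-≤-trans (ℚP.≤-<-trans (cubic-mono 0≤k (ℚP.≤-trans (k≤lo b) (lo≤hi b)) hi≤s+w) g<c) (c≤cubic-hi b))
      split : ∀ l u s w → l - s ≡ (w - (u - l)) + (u - (s + w))
      split = solve-∀ ℚ-ring

    hi-below : ∀ {s w} b → width b < w → c < cubic k (s - w) → hi b < s
    hi-below {s} {w} b thin c<g = 0<q-p⇒p<q (subst (0ℚ <_) (sym (split (lo b) (hi b) s w))
      (+-pos (p<q⇒0<q-p thin) (ℚP.<⇒≤ (p<q⇒0<q-p lo<s-w))))
      where
      lo<s-w : lo b < s - w
      lo<s-w = ℚP.≰⇒> λ s-w≤lo → ℚP.<-irrefl refl
        (ℚP.<-≤-trans c<g (ℚP.≤-trans (cubic-mono 0≤k (ℚP.<⇒≤ (c<cubic⇒k< (s - w) 0≤c c<g)) s-w≤lo)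
                                      (cubic-lo≤c b)))
      split : ∀ l u s w → s - u ≡ (w - (u - l)) + ((s - w) - l)
      split = solve-∀ ℚ-ring

    ρ-eventually-> : ∀ s → cubic k s < c → Eventually (λ n → s < ρ n)
    ρ-eventually-> s g<c with s ℚP.<? k
    ... | yes s<k = 0 , λ n _ → ℚP.<-≤-trans s<k (k≤ρ n)
    ... | no  s≮k =
      let w , 0<w , g[s+w]<c = cubic-gap-above s 0≤k (ℚP.≮⇒≥ s≮k) g<c
          b , thin = narrow 0<w
      in from b , λ n from≤n → ℚP.<-≤-trans (below-lo b thin g[s+w]<c) (proj₁ (lo≤ρ≤hi b n from≤n))

    ρ-eventually-< : ∀ s → c < cubic k s → Eventually (λ n → ρ n < s)
    ρ-eventually-< s c<g =
      let w , 0<w , c<g[s-w] = cubic-gap-below s 1≤k (c<cubic⇒k< s 0≤c c<g) c<g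
          b , thin = narrow 0<w
      in from b , λ n from≤n → ℚP.≤-<-trans (proj₂ (lo≤ρ≤hi b n from≤n)) (hi-below b thin c<g[s-w])

  module Inversion (α : ℚ) where

    D : ℚ
    D = α * α - 1ℚ

    x-of : (ρ : ℚ) → .(0ℚ < ρ - α + 1ℚ) → ℚ
    x-of ρ 0<d = 1ℚ + D * recip (ρ - α + 1ℚ) 0<d

    1<x-of : 0ℚ < D → ∀ {ρ} (0<d : 0ℚ < ρ - α + 1ℚ) → 1ℚ < x-of ρ 0<d
    1<x-of 0<D {ρ} 0<d = <-rearrange (shift (D * recip (ρ - α + 1ℚ) 0<d)) (*-pos 0<D (recip-pos 0<d))
      where
      shift : ∀ y → y - 0ℚ ≡ 1ℚ + y - 1ℚ
      shift = solve-∀ ℚ-ring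

    ρ-of : (t : ℚ) → .(1ℚ < t) → ℚ
    ρ-of t 1<t = (α - 1ℚ) + D * recip (t - 1ℚ) (p<q⇒0<q-p 1<t)

    <ρ-of⇒<x-of : ∀ {ρ t} (0<d : 0ℚ < ρ - α + 1ℚ) (1<t : 1ℚ < t) → ρ < ρ-of t 1<t → t < x-of ρ 0<d
    <ρ-of⇒<x-of {ρ} {t} 0<d 1<t ρ<ρt =
      <-rearrange (shift₂ t (D * recip (ρ - α + 1ℚ) 0<d))
                  (recip-swap-< D (p<q⇒0<q-p 1<t) 0<d (<-rearrange (shift₁ α ρ _) ρ<ρt))
      where
      shift₁ : ∀ α ρ y → (α - 1ℚ) + y - ρ ≡ y - (ρ - α + 1ℚ)
      shift₁ = solve-∀ ℚ-ring
      shift₂ : ∀ t y → y - (t - 1ℚ) ≡ 1ℚ + y - t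
      shift₂ = solve-∀ ℚ-ring

    ρ-of<⇒x-of< : ∀ {ρ t} (0<d : 0ℚ < ρ - α + 1ℚ) (1<t : 1ℚ < t) → ρ-of t 1<t < ρ → x-of ρ 0<d < t
    ρ-of<⇒x-of< {ρ} {t} 0<d 1<t ρt<ρ =
      <-rearrange (shift₂ t (D * recip (ρ - α + 1ℚ) 0<d))
                  (recip-swap-> D (p<q⇒0<q-p 1<t) 0<d (<-rearrange (shift₁ α ρ _) ρt<ρ))
      where
      shift₁ : ∀ α ρ y → ρ - ((α - 1ℚ) + y) ≡ (ρ - α + 1ℚ) - y
      shift₁ = solve-∀ ℚ-ring
      shift₂ : ∀ t y → (t - 1ℚ) - y ≡ t - (1ℚ + y)
      shift₂ = solve-∀ ℚ-ring

    k : ℚ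
    k = ⟦ 3 ⟧ * α

    c : ℚ
    c = α * (α - 1ℚ) * (α * (α - 1ℚ))

    -- ρ-of t is the ratio at which x-of takes the value t; it maps the cubic (ρ - k) ρ² = c to t³ = α².
    ρ-of-cubic : ∀ t (1<t : 1ℚ < t) →
      (cubic k (ρ-of t 1<t) - c) * ((t - 1ℚ) * (t - 1ℚ) * (t - 1ℚ)) ≡ D * D * (α * α - t * t * t)
    ρ-of-cubic t 1<t = begin
      (cubic k U - c) * (e * e * e)                        ≡⟨ spread U k c e ⟩
      (U * e - k * e) * (U * e) * (U * e) - c * (e * e * e) ≡⟨ cong (λ V → (V - k * e) * V * V - c * (e * e * e)) Ue ⟩
      (V - k * e) * V * V - c * (e * e * e)                ≡⟨ eliminate α e ⟩
      D * D * (α * α - (1ℚ + e) * (1ℚ + e) * (1ℚ + e))     ≡⟨ cong (λ z → D * D * (α * α - z * z * z)) (1+[t-1] t) ⟩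
      D * D * (α * α - t * t * t)                          ∎
      where
      open ≡-Reasoning
      e U V : ℚ
      e = t - 1ℚ
      U = ρ-of t 1<t
      V = (α - 1ℚ) * e + D
      Ue : U * e ≡ V
      Ue = trans (distrib (α - 1ℚ) D (recip e (p<q⇒0<q-p 1<t)) e)
                 (cong ((α - 1ℚ) * e +_) (recip-*-cancel (p<q⇒0<q-p 1<t) D))
        where
        distrib : ∀ a D r e → (a + D * r) * e ≡ a * e + D * r * e
        distrib = solve-∀ ℚ-ring
      spread : ∀ U k c e →
        ((U - k) * U * U - c) * (e * e * e) ≡ (U * e - k * e) * (U * e) * (U * e) - c * (e * e * e)
      spread = solve-∀ ℚ-ring
      eliminate : ∀ α e →
        ((α - 1ℚ) * e + (α * α - 1ℚ) - ⟦ 3 ⟧ * α * e) * ((α - 1ℚ) * e + (α * α - 1ℚ)) * ((α - 1ℚ) * e + (α * α - 1ℚ))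
          - α * (α - 1ℚ) * (α * (α - 1ℚ)) * (e * e * e)
        ≡ (α * α - 1ℚ) * (α * α - 1ℚ) * (α * α - (1ℚ + e) * (1ℚ + e) * (1ℚ + e))
      eliminate = solve-∀ ℚ-ring
      1+[t-1] : ∀ t → 1ℚ + (t - 1ℚ) ≡ t
      1+[t-1] = solve-∀ ℚ-ring

    module _ (1<α : 1ℚ < α) {t} (1<t : 1ℚ < t) where

      0<D : 0ℚ < D
      0<D = <-rearrange (factor α) (*-pos (p<q⇒0<q-p 1<α) (+-pos (ℚP.<-trans (ℚP.positive⁻¹ 1ℚ) 1<α) 0≤1))
        where
        factor : ∀ α → (α - 1ℚ) * (α + 1ℚ) - 0ℚ ≡ α * α - 1ℚ - 0ℚ
        factor = solve-∀ ℚ-ring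

      e³ : ℚ
      e³ = (t - 1ℚ) * (t - 1ℚ) * (t - 1ℚ)

      0<e³ : 0ℚ < e³
      0<e³ = *-pos (*-pos (p<q⇒0<q-p 1<t) (p<q⇒0<q-p 1<t)) (p<q⇒0<q-p 1<t)

      c<cubic-ρ-of : t * t * t < α * α → c < cubic k (ρ-of t 1<t)
      c<cubic-ρ-of t³<α² = 0<q-p⇒p<q (*-cancelʳ-< (ℚP.<⇒≤ 0<e³)
        (subst₂ _<_ (sym (ℚP.*-zeroˡ e³)) (sym (ρ-of-cubic t 1<t)) (*-pos (*-pos 0<D 0<D) (p<q⇒0<q-p t³<α²))))

      cubic-ρ-of<c : α * α < t * t * t → cubic k (ρ-of t 1<t) < c
      cubic-ρ-of<c α²<t³ = 0<q-p⇒p<q (*-cancelʳ-< (ℚP.<⇒≤ 0<e³)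
        (subst₂ _<_ (sym (ℚP.*-zeroˡ e³)) (sym flipped) (*-pos (*-pos 0<D 0<D) (p<q⇒0<q-p α²<t³))))
        where
        open ≡-Reasoning
        g : ℚ
        g = cubic k (ρ-of t 1<t)
        neg₁ : ∀ g c e → (c - g) * e ≡ - ((g - c) * e)
        neg₁ = solve-∀ ℚ-ring
        neg₂ : ∀ D a t → - (D * D * (a - t)) ≡ D * D * (t - a)
        neg₂ = solve-∀ ℚ-ring
        flipped : (c - g) * e³ ≡ D * D * (t * t * t - α * α)
        flipped = begin
          (c - g) * e³                  ≡⟨ neg₁ g c e³ ⟩
          - ((g - c) * e³)              ≡⟨ cong -_ (ρ-of-cubic t 1<t) ⟩
          - (D * D * (α * α - t * t * t)) ≡⟨ neg₂ D (α * α) (t * t * t) ⟩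
          D * D * (t * t * t - α * α)   ∎

  ÷₀-pos : ∀ p {q} (0<q : 0ℚ < q) → p ÷₀ q ≡ p * recip q 0<q
  ÷₀-pos p {q} 0<q with q ℚ.≟ 0ℚ
  ... | yes q≡0 = ⊥-elim (ℚP.<⇒≢ 0<q (sym q≡0))
  ... | no  _   = refl

  1<-of-above : ∀ {a r} → 1ℚ ≤ a → 0ℚ ≤ r → a * a < r * r * r → 1ℚ < r
  1<-of-above 1≤a 0≤r a²<r³ = ℚP.≰⇒> λ r≤1 →
    ℚP.<-irrefl refl (ℚP.<-≤-trans a²<r³ (ℚP.≤-trans (cube-mono-≤ 0≤r r≤1) (*-mono-≤ 0≤1 0≤1 1≤a 1≤a)))

  below-1⇒<1 : ∀ {q} → below 1 q → q < 1ℚ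
  below-1⇒<1 (inj₁ q<0)  = ℚP.<-trans q<0 (ℚP.positive⁻¹ 1ℚ)
  below-1⇒<1 (inj₂ q³<1) = ℚP.≰⇒> λ 1≤q → ℚP.<-irrefl refl (ℚP.<-≤-trans q³<1 (cube-mono-≤ 0≤1 1≤q))

  module Sequence (β : ℕ) where

    α : ℕ
    α = suc β

    open Inversion ⟦ α ⟧

    A : ℕ → ℚ
    A n = ⟦ a α n ⟧

    ⟦3α⟧≡k : ⟦ 3 ℕ.* α ⟧ ≡ k
    ⟦3α⟧≡k = ⟦⟧-* 3 α

    ⟦γ⟧≡c : ⟦ γ α ⟧ ≡ c
    ⟦γ⟧≡c = begin
      ⟦ α ℕ.* β ℕ.* (α ℕ.* β ℕ.* 1) ⟧       ≡⟨ ⟦⟧-* (α ℕ.* β) (α ℕ.* β ℕ.* 1) ⟩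
      ⟦ α ℕ.* β ⟧ * ⟦ α ℕ.* β ℕ.* 1 ⟧       ≡⟨ cong (⟦ α ℕ.* β ⟧ *_) (cong ⟦_⟧ (ℕP.*-identityʳ (α ℕ.* β))) ⟩
      ⟦ α ℕ.* β ⟧ * ⟦ α ℕ.* β ⟧             ≡⟨ cong (λ p → p * p) (trans (⟦⟧-* α β) (cong (⟦ α ⟧ *_) ⟦β⟧≡α-1)) ⟩
      c                                     ∎
      where
      open ≡-Reasoning
      ⟦β⟧≡α-1 : ⟦ β ⟧ ≡ ⟦ α ⟧ - 1ℚ
      ⟦β⟧≡α-1 = sym (trans (cong (_- 1ℚ) (⟦⟧-+ 1 β)) (cancel ⟦ β ⟧))
        where
        cancel : ∀ b → 1ℚ + b - 1ℚ ≡ b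
        cancel = solve-∀ ℚ-ring

    A-pos : ∀ n → 0ℚ < A n
    A-pos n = ⟦⟧-mono-< (a-pos (s≤s z≤n) n)

    A-grows : ∀ n → k * A n ≤ A (suc n)
    A-grows n =
      subst (_≤ A (suc n)) (trans (⟦⟧-* (3 ℕ.* α) (a α n)) (cong (_* A n) ⟦3α⟧≡k)) (⟦⟧-mono-≤ (a-grows α n))

    A-rec : ∀ n → A (3 ℕ.+ n) ≡ k * A (2 ℕ.+ n) + c * A n
    A-rec n = begin
      ⟦ a α (3 ℕ.+ n) ⟧                                          ≡⟨ cong ⟦_⟧ (a-rec α n) ⟩
      ⟦ 3 ℕ.* α ℕ.* a α (2 ℕ.+ n) ℕ.+ γ α ℕ.* a α n ⟧            ≡⟨ ⟦⟧-+ (3 ℕ.* α ℕ.* a α (2 ℕ.+ n)) (γ α ℕ.* a α n) ⟩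
      ⟦ 3 ℕ.* α ℕ.* a α (2 ℕ.+ n) ⟧ + ⟦ γ α ℕ.* a α n ⟧          ≡⟨ cong₂ _+_ (⟦⟧-* (3 ℕ.* α) (a α (2 ℕ.+ n))) (⟦⟧-* (γ α) (a α n)) ⟩
      ⟦ 3 ℕ.* α ⟧ * A (2 ℕ.+ n) + ⟦ γ α ⟧ * A n                 ≡⟨ cong₂ (λ k′ c′ → k′ * A (2 ℕ.+ n) + c′ * A n) ⟦3α⟧≡k ⟦γ⟧≡c ⟩
      k * A (2 ℕ.+ n) + c * A n                                 ∎
      where open ≡-Reasoning

    1≤k : 1ℚ ≤ k
    1≤k = subst (1ℚ ≤_) ⟦3α⟧≡k (⟦⟧-mono-≤ {n = 3 ℕ.* α} (s≤s z≤n))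

    0≤c : 0ℚ ≤ c
    0≤c = subst (0ℚ ≤_) ⟦γ⟧≡c (⟦⟧-mono-≤ {n = γ α} z≤n)

    open Recurrent k c A 1≤k 0≤c A-pos A-grows A-rec public using (ρ; k≤ρ; ρ-eventually->; ρ-eventually-<)

    0<d : ∀ m → 0ℚ < ρ m - ⟦ α ⟧ + 1ℚ
    0<d m = subst (0ℚ <_) (ℚP.+-comm 1ℚ (ρ m - ⟦ α ⟧)) (+-pos (ℚP.positive⁻¹ 1ℚ) (p≤q⇒0≤q-p α≤ρ))
      where
      α≤ρ : ⟦ α ⟧ ≤ ρ m
      α≤ρ = ℚP.≤-trans (subst (⟦ α ⟧ ≤_) ⟦3α⟧≡k (⟦⟧-mono-≤ (ℕP.m≤n*m α 3))) (k≤ρ m)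

    a≢0 : ∀ m → ⟦ a α m ⟧ ≢ 0ℚ
    a≢0 m = ℚP.<⇒≢ (A-pos m) ∘ sym

    den-suc : ∀ m → den α (suc m) ≡ ρ m - ⟦ α ⟧ + 1ℚ
    den-suc m = cong (λ r → r - ⟦ α ⟧ + 1ℚ) (÷₀-pos (A (suc m)) (A-pos m))

    den≢0 : ∀ m → den α (suc m) ≢ 0ℚ
    den≢0 m = ℚP.<⇒≢ (0<d m) ∘ sym ∘ trans (sym (den-suc m))

    x-suc : ∀ m → x α (suc m) ≡ x-of (ρ m) (0<d m)
    x-suc m = cong (1ℚ +_) (trans (cong (D ÷₀_) (den-suc m)) (÷₀-pos D (0<d m)))

    module _ (1<α : 1ℚ < ⟦ α ⟧) where

      x-eventually-> : ∀ {q} → below α q → Eventually (λ m → q < x α (suc m))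
      x-eventually-> {q} q<α^⅔ = by-cases (q ℚP.≤? 1ℚ)
        where
        cube< : below α q → 1ℚ < q → q * q * q < ⟦ α ⟧ * ⟦ α ⟧
        cube< (inj₁ q<0)   1<q = ⊥-elim (ℚP.<-asym q<0 (ℚP.<-trans (ℚP.positive⁻¹ 1ℚ) 1<q))
        cube< (inj₂ q³<α²) _   = q³<α²
        by-cases : Dec (q ≤ 1ℚ) → Eventually (λ m → q < x α (suc m))
        by-cases (yes q≤1) = 0 , λ m _ →
          ℚP.≤-<-trans q≤1 (subst (1ℚ <_) (sym (x-suc m)) (1<x-of (0<D 1<α 1<α) {ρ m} (0<d m)))
        by-cases (no q≰1) =
          let 1<q = ℚP.≰⇒> q≰1
              N , ρ<ρ-of-q = ρ-eventually-< (ρ-of q 1<q) (c<cubic-ρ-of 1<α 1<q (cube< q<α^⅔ 1<q))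
          in N , λ m N≤m →
            subst (q <_) (sym (x-suc m)) (<ρ-of⇒<x-of {ρ m} {q} (0<d m) 1<q (ρ<ρ-of-q m N≤m))

      x-eventually-< : ∀ {r} → above α r → Eventually (λ m → x α (suc m) < r)
      x-eventually-< {r} (0≤r , α²<r³) =
        let 1<r = 1<-of-above (ℚP.<⇒≤ 1<α) 0≤r α²<r³
            N , ρ-of-r<ρ = ρ-eventually-> (ρ-of r 1<r) (cubic-ρ-of<c 1<α 1<r α²<r³)
        in N , λ m N≤m → subst (_< r) (sym (x-suc m)) (ρ-of<⇒x-of< {ρ m} {r} (0<d m) 1<r (ρ-of-r<ρ m N≤m))

  x-eventually-between : ∀ β {q r} → below (suc β) q → above (suc β) r →
                         Eventually (λ m → q < x (suc β) (suc m) × x (suc β) (suc m) < r)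
  x-eventually-between zero {q} {r} q<1 (0≤r , 1<r³) =
    0 , λ m _ → subst (q <_) (sym (x≡1 m)) (below-1⇒<1 q<1)
              , subst (_< r) (sym (x≡1 m)) (1<-of-above ℚP.≤-refl 0≤r 1<r³)
    where
    open Sequence zero
    -- Here D = ⟦ 1 ⟧ * ⟦ 1 ⟧ - 1ℚ reduces to 0ℚ.
    x≡1 : ∀ m → x 1 (suc m) ≡ 1ℚ
    x≡1 m = trans (x-suc m)
                  (trans (cong (1ℚ +_) (ℚP.*-zeroˡ (recip (ρ m - ⟦ 1 ⟧ + 1ℚ) (0<d m)))) (ℚP.+-identityʳ 1ℚ))
  x-eventually-between β@(suc _) q<α^⅔ α^⅔<r =
    eventually-× (x-eventually-> 1<α q<α^⅔) (x-eventually-< 1<α α^⅔<r)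
    where
    open Sequence β
    1<α : 1ℚ < ⟦ α ⟧
    1<α = ⟦⟧-mono-< {1} {α} (s≤s (s≤s z≤n))

open import Data.Nat using (ℕ; zero; suc; _≤_; _∸_; s≤s)
open import Data.Rational using (ℚ; 0ℚ; _<_)
open import Data.Product using (_×_; _,_; ∃-syntax)
open import Relation.Binary.PropositionalEquality using (_≢_)
open Ratios using (x-eventually-between; module Sequence)

corollary4 : (α : ℕ) → 1 ≤ α → (q r : ℚ) → below α q → above α r →
    ∃[ N ] ((n : ℕ) → N ≤ n → 1 ≤ n →
      (⟦ a α (n ∸ 1) ⟧ ≢ 0ℚ) × (den α n ≢ 0ℚ) × (q < x α n) × (x α n < r))
corollary4 (suc β) _ q r q<α^⅔ α^⅔<r =
  let N , between = x-eventually-between β q<α^⅔ α^⅔<r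
  in suc N , λ { (suc m) (s≤s N≤m) _ → a≢0 m , den≢0 m , between m N≤m }
  where open Sequence β using (a≢0; den≢0)
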